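{- Let $C$ be a command, $(s,h)\in\mathcal{S}$, $\rho$ a resource configuration, and $h_F$ a heap with $h\bot h_F$. If $C,(s,h,\rho)\not\to_p\mathsf{abort}$, then $C,(s,h\uplus h_F,\rho)\not\to_p\mathsf{abort}$.
   Context: $\mathcal{S}$: pairs $(s,h)$ of a store $s:\mathbf{Var}\to\mathbf{Val}$ and a finite partial heap $h:\mathbf{Loc}\rightharpoonup\mathbf{Val}$; $h\bot h_F$ means disjoint domains and $h\uplus h_F$ is their union. A resource configuration is a triple $\rho=(O,L,D)$ of pairwise disjoint sets of resource names; $r\in\rho$ iff $r\in O\cup L\cup D$; $\rho\setminus\{r\}$ componentwise removal. Commands: $\mathsf{skip}$, basic commands $c$ ($x:=e$, $x:=[e]$, $[e]:=e'$, $x:=\mathsf{cons}(e_1,\dots,e_n)$, $\mathsf{dispose}(e)$), $C_1;C_2$, conditionals, while loops, $\mathsf{resource}\ r\ \mathsf{in}\ C$, $\mathsf{with}\ r\ \mathsf{when}\ B\ \mathsf{do}\ C$, $C_1\|C_2$, $\mathsf{within}\ r\ \mathsf{do}\ C$. $[c](s,h)$ is the standard separation-logic semantics of basic commands: $x:=e$ updates the store; $x:=[e]$, $[e]:=e'$, $\mathsf{dispose}(e)$ yield $\mathsf{abort}$ iff the value of $e$ is not in $dom(h)$; $\mathsf{cons}$ allocates fresh consecutive cells. $Locked(C_1;C_2)=Locked(C_1)$, $Locked(C_1\|C_2)=Locked(C_1)\cup Locked(C_2)$, $Locked(\mathsf{resource}\ r\ \mathsf{in}\ C)=Locked(C)\setminus\{r\}$,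 $Locked(\mathsf{within}\ r\ \mathsf{do}\ C)=Locked(C)\cup\{r\}$, else $\emptyset$. The relation $C,(s,h,\rho)\to_p\mathsf{abort}$ is the least one closed under: (RA) $\mathsf{resource}\ r\ \mathsf{in}\ C,(s,h,\rho)\to_p\mathsf{abort}$ if $r\in\rho$; (WA) $\mathsf{with}\ r\ \mathsf{when}\ B\ \mathsf{do}\ C,(s,h,\rho)\to_p\mathsf{abort}$ if $r\notin\rho$; (RA1) $\mathsf{resource}\ r\ \mathsf{in}\ C,(s,h,(O,L,D))\to_p\mathsf{abort}$ if $r\in Locked(C)$ and $C,(s,h,(O\cup\{r\},L,D))\to_p\mathsf{abort}$; (RA2) same if $r\notin Locked(C)$ and $C,(s,h,(O,L,D\cup\{r\}))\to_p\mathsf{abort}$; (BCA) $c,(s,h,\rho)\to_p\mathsf{abort}$ if $[c](s,h)=\mathsf{abort}$; (SA) $C_1;C_2$ aborts if $C_1$ aborts (same state); (WA1) $\mathsf{within}\ r\ \mathsf{do}\ C,(s,h,\rho)\to_p\mathsf{abort}$ if $C,(s,h,\rho\setminus\{r\})\to_p\mathsf{abort}$; (WA2) $\mathsf{within}\ r\ \mathsf{do}\ C,(s,h,(O,L,D))\to_p\mathsf{abort}$ if $r\notin O$; (PA1/PA2) $C_1\|C_2$ aborts if $C_1$ or $C_2$ aborts (same state). $C,\sigma\not\to_p\mathsf{abort}$ means this does not hold. -}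

module Defs where

open import Data.Nat using (ℕ)
open import Data.Integer using (ℤ; _+_; _-_; _*_) renaming (_≟_ to _≟ℤ_; _≤?_ to _≤?ℤ_)
open import Data.Bool using (Bool; true; false; not; _∧_)
open import Data.Maybe using (Maybe; just; nothing)
open import Data.List using (List; _++_)
open import Data.List.Membership.Propositional using (_∈_)
open import Data.Product using (∃; _×_; _,_)
open import Data.Sum using (_⊎_)
open import Data.Empty using (⊥)
open import Relation.Nullary using (¬_; does)
open import Relation.Binary.PropositionalEquality using (_≡_; _≢_)

-- Variables, values, locations (Loc ⊆ Val = ℤ, as in Reynolds' model), resource names
Var : Set
Var = ℕ

Val : Set
Val = ℤ

Loc : Set
Loc = ℤ

RName : Set
RName = ℕ

Store : Set
Store = Var → Val

record Heap : Set where
  field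
    look   : Loc → Maybe Val
    finite : ∃ λ (xs : List Loc) → ∀ l → look l ≢ nothing → l ∈ xs
open Heap public

_∈dom_ : Loc → Heap → Set
l ∈dom h = look h l ≢ nothing

_⊥ₕ_ : Heap → Heap → Set
h ⊥ₕ hF = ∀ l → look h l ≡ nothing ⊎ look hF l ≡ nothing

private
  pick : Maybe Val → Maybe Val → Maybe Val
  pick (just v) _ = just v
  pick nothing  m = m

  pick-fin : ∀ {A : Set} (a b : Maybe Val) → (a ≢ nothing → A) → (b ≢ nothing → A)
           → pick a b ≢ nothing → A
  pick-fin (just v) b f g p = f (λ ())
  pick-fin nothing  b f g p = g p

open import Data.List.Membership.Propositional.Properties using (∈-++⁺ˡ; ∈-++⁺ʳ)

-- h ⊎ hF : union of heaps (meaningful when disjoint)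
_⊎ₕ_ : Heap → Heap → Heap
look (h ⊎ₕ hF) l = pick (look h l) (look hF l)
finite (h ⊎ₕ hF) with finite h | finite hF
... | xs , p | ys , q =
  xs ++ ys , λ l ne → pick-fin (look h l) (look hF l)
                        (λ n → ∈-++⁺ˡ (p l n)) (λ n → ∈-++⁺ʳ xs (q l n)) ne

data Expr : Set where
  var  : Var → Expr
  lit  : Val → Expr
  _⊕_  : Expr → Expr → Expr
  _⊖_  : Expr → Expr → Expr
  _⊛_  : Expr → Expr → Expr

⟦_⟧ : Expr → Store → Val
⟦ var x ⟧ s = s x
⟦ lit v ⟧ s = v
⟦ e ⊕ e' ⟧ s = ⟦ e ⟧ s + ⟦ e' ⟧ s
⟦ e ⊖ e' ⟧ s = ⟦ e ⟧ s - ⟦ e' ⟧ s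
⟦ e ⊛ e' ⟧ s = ⟦ e ⟧ s * ⟦ e' ⟧ s

data BExpr : Set where
  btrue bfalse : BExpr
  _≐_ _≤ᵇ_     : Expr → Expr → BExpr
  bnot         : BExpr → BExpr
  _band_       : BExpr → BExpr → BExpr

⟦_⟧ᵇ : BExpr → Store → Bool
⟦ btrue ⟧ᵇ s = true
⟦ bfalse ⟧ᵇ s = false
⟦ e ≐ e' ⟧ᵇ s = does (⟦ e ⟧ s ≟ℤ ⟦ e' ⟧ s)
⟦ e ≤ᵇ e' ⟧ᵇ s = does (⟦ e ⟧ s ≤?ℤ ⟦ e' ⟧ s)
⟦ bnot b ⟧ᵇ s = not (⟦ b ⟧ᵇ s)
⟦ b band b' ⟧ᵇ s = ⟦ b ⟧ᵇ s ∧ ⟦ b' ⟧ᵇ s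

data BasicCmd : Set where
  assign  : Var → Expr → BasicCmd
  load    : Var → Expr → BasicCmd
  store   : Expr → Expr → BasicCmd
  cons    : Var → List Expr → BasicCmd
  dispose : Expr → BasicCmd

data BasicAborts : BasicCmd → Store → Heap → Set where
  load-abort    : ∀ {x e s h} → ¬ (⟦ e ⟧ s ∈dom h) → BasicAborts (load x e) s h
  store-abort   : ∀ {e e' s h} → ¬ (⟦ e ⟧ s ∈dom h) → BasicAborts (store e e') s h
  dispose-abort : ∀ {e s h} → ¬ (⟦ e ⟧ s ∈dom h) → BasicAborts (dispose e) s h

data Cmd : Set where
  skip     : Cmd
  basic    : BasicCmd → Cmd
  _⨾_      : Cmd → Cmd → Cmd
  ifte     : BExpr → Cmd → Cmd → Cmd
  while   : BExpr → Cmd → Cmd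
  resource : RName → Cmd → Cmd
  withWhen : RName → BExpr → Cmd → Cmd
  _∥_      : Cmd → Cmd → Cmd
  within   : RName → Cmd → Cmd

data _∈Locked_ (r : RName) : Cmd → Set where
  seq    : ∀ {C₁ C₂} → r ∈Locked C₁ → r ∈Locked (C₁ ⨾ C₂)
  parˡ   : ∀ {C₁ C₂} → r ∈Locked C₁ → r ∈Locked (C₁ ∥ C₂)
  parʳ   : ∀ {C₁ C₂} → r ∈Locked C₂ → r ∈Locked (C₁ ∥ C₂)
  res    : ∀ {r' C} → r ≢ r' → r ∈Locked C → r ∈Locked (resource r' C)
  within-here : ∀ {C} → r ∈Locked (within r C)
  within-there : ∀ {r' C} → r ∈Locked C → r ∈Locked (within r' C)

RSet : Set₁
RSet = RName → Set

_∪｛_｝ : RSet → RName → RSet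
(A ∪｛ r ｝) x = A x ⊎ x ≡ r

_∖｛_｝ : RSet → RName → RSet
(A ∖｛ r ｝) x = A x × x ≢ r

record RConf : Set₁ where
  constructor ⟨_,_,_⟩
  field
    O L D : RSet
open RConf public

PairwiseDisjoint : RConf → Set
PairwiseDisjoint ρ = ∀ r → ¬ (O ρ r × L ρ r) × ¬ (O ρ r × D ρ r) × ¬ (L ρ r × D ρ r)

_∈ρ_ : RName → RConf → Set
r ∈ρ ρ = O ρ r ⊎ L ρ r ⊎ D ρ r

_∖ρ_ : RConf → RName → RConf
ρ ∖ρ r = ⟨ O ρ ∖｛ r ｝ , L ρ ∖｛ r ｝ , D ρ ∖｛ r ｝ ⟩

data Aborts : Cmd → Store → Heap → RConf → Set₁ where
  RA  : ∀ {r C s h ρ} → r ∈ρ ρ → Aborts (resource r C) s h ρ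
  WA  : ∀ {r B C s h ρ} → ¬ (r ∈ρ ρ) → Aborts (withWhen r B C) s h ρ
  RA1 : ∀ {r C s h O L D} → r ∈Locked C → Aborts C s h ⟨ O ∪｛ r ｝ , L , D ⟩
      → Aborts (resource r C) s h ⟨ O , L , D ⟩
  RA2 : ∀ {r C s h O L D} → ¬ (r ∈Locked C) → Aborts C s h ⟨ O , L , D ∪｛ r ｝ ⟩
      → Aborts (resource r C) s h ⟨ O , L , D ⟩
  BCA : ∀ {c s h ρ} → BasicAborts c s h → Aborts (basic c) s h ρ
  SA  : ∀ {C₁ C₂ s h ρ} → Aborts C₁ s h ρ → Aborts (C₁ ⨾ C₂) s h ρ
  WA1 : ∀ {r C s h ρ} → Aborts C s h (ρ ∖ρ r) → Aborts (within r C) s h ρ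
  WA2 : ∀ {r C s h O L D} → ¬ (O r) → Aborts (within r C) s h ⟨ O , L , D ⟩
  PA1 : ∀ {C₁ C₂ s h ρ} → Aborts C₁ s h ρ → Aborts (C₁ ∥ C₂) s h ρ
  PA2 : ∀ {C₁ C₂ s h ρ} → Aborts C₂ s h ρ → Aborts (C₁ ∥ C₂) s h ρ

module Submission where

open import Defs
open import Data.Maybe using (just; nothing)
open import Function using (_∘_)
open import Relation.Nullary using (¬_)
open import Relation.Binary.PropositionalEquality using (refl)

-- Only
-- basic commands inspect the heap, and they abort exactly when an address is
-- outside the domain; since dom h ⊆ dom (h ⊎ₕ hF), such an address is also
-- outside dom h. So every abort on the larger heap is already an abort on h.

∉dom-⊎ₕ⇒∉dom : ∀ l h hF → ¬ (l ∈dom (h ⊎ₕ hF)) → ¬ (l ∈dom h)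
∉dom-⊎ₕ⇒∉dom l h hF l∉h⊎hF l∈h with look h l
... | just _  = l∉h⊎hF (λ ())
... | nothing = l∈h refl

basicAborts-⊎ₕ⇒basicAborts : ∀ {c s h hF} → BasicAborts c s (h ⊎ₕ hF) → BasicAborts c s h
basicAborts-⊎ₕ⇒basicAborts {s = s} {h} {hF} (load-abort {e = e} e∉) =
  load-abort (∉dom-⊎ₕ⇒∉dom (⟦ e ⟧ s) h hF e∉)
basicAborts-⊎ₕ⇒basicAborts {s = s} {h} {hF} (store-abort {e = e} e∉) =
  store-abort (∉dom-⊎ₕ⇒∉dom (⟦ e ⟧ s) h hF e∉)
basicAborts-⊎ₕ⇒basicAborts {s = s} {h} {hF} (dispose-abort {e = e} e∉) =
  dispose-abort (∉dom-⊎ₕ⇒∉dom (⟦ e ⟧ s) h hF e∉)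

aborts-⊎ₕ⇒aborts : ∀ {C s h hF ρ} → Aborts C s (h ⊎ₕ hF) ρ → Aborts C s h ρ
aborts-⊎ₕ⇒aborts (RA r∈ρ)           = RA r∈ρ
aborts-⊎ₕ⇒aborts (WA r∉ρ)           = WA r∉ρ
aborts-⊎ₕ⇒aborts (RA1 r∈locked ab)  = RA1 r∈locked (aborts-⊎ₕ⇒aborts ab)
aborts-⊎ₕ⇒aborts (RA2 r∉locked ab)  = RA2 r∉locked (aborts-⊎ₕ⇒aborts ab)
aborts-⊎ₕ⇒aborts (BCA ab)           = BCA (basicAborts-⊎ₕ⇒basicAborts ab)
aborts-⊎ₕ⇒aborts (SA ab)            = SA (aborts-⊎ₕ⇒aborts ab)
aborts-⊎ₕ⇒aborts (WA1 ab)           = WA1 (aborts-⊎ₕ⇒aborts ab)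
aborts-⊎ₕ⇒aborts (WA2 r∉O)          = WA2 r∉O
aborts-⊎ₕ⇒aborts (PA1 ab)           = PA1 (aborts-⊎ₕ⇒aborts ab)
aborts-⊎ₕ⇒aborts (PA2 ab)           = PA2 (aborts-⊎ₕ⇒aborts ab)

proposition4 : (C : Cmd) (s : Store) (h : Heap) (ρ : RConf) (hF : Heap)
    → PairwiseDisjoint ρ → h ⊥ₕ hF
    → ¬ Aborts C s h ρ → ¬ Aborts C s (h ⊎ₕ hF) ρ
proposition4 C s h ρ hF _ _ ¬aborts = ¬aborts ∘ aborts-⊎ₕ⇒aborts
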